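{- Let $a>3$ be an odd integer and let $N=a^2-4$. Then each of the two real numbers $\frac{\sqrt{N}+1}{4}$ and $\frac{\sqrt{N}-1}{4}$ is equivalent to $\sqrt{N}$.
   Context: Two irrational real numbers $x,y$ are called equivalent if $y=\frac{px+q}{rx+s}$ for some integers $p,q,r,s$ with $ps-qr=\pm1$; equivalently, their simple continued fraction expansions eventually coincide (for quadratic irrationals: their periodic parts are equal). -}

module Defs where

open import Data.Nat as ℕ using (ℕ)
open import Data.Integer as ℤ using (ℤ; +_)
open import Data.Rational as ℚ using (ℚ; _/_; 0ℚ)
open import Data.Product using (_×_; _,_; ∃-syntax)
open import Data.Sum using (_⊎_)
open import Relation.Binary.PropositionalEquality using (_≡_)
open import Relation.Nullary using (¬_)

-- The real quadratic field ℚ(√N), for a fixed non-square N ∈ ℕ, modelled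
-- concretely: the pair u + v √ stands for the real number u + v·√N.
-- When N is not a perfect square this is an injective ring embedding into ℝ,
-- so equality of pairs is equality of the real numbers.
record QSqrt (N : ℕ) : Set where
  constructor _+_√
  field
    re : ℚ
    im : ℚ

module _ {N : ℕ} where
  infixl 6 _⊕_
  infixl 7 _⊗_

  _⊕_ : QSqrt N → QSqrt N → QSqrt N
  (u + v √) ⊕ (u' + v' √) = (u ℚ.+ u') + (v ℚ.+ v') √

  _⊗_ : QSqrt N → QSqrt N → QSqrt N
  (u + v √) ⊗ (u' + v' √) =
    (u ℚ.* u' ℚ.+ ((+ N) / 1) ℚ.* (v ℚ.* v')) + (u ℚ.* v' ℚ.+ v ℚ.* u') √

ι : (N : ℕ) → ℤ → QSqrt N
ι N z = (z / 1) + 0ℚ √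

√N : (N : ℕ) → QSqrt N
√N N = 0ℚ + ℚ.1ℚ √

-- Equivalence of x and y: y = (p x + q)/(r x + s) for integers p,q,r,s with
-- ps - qr = ±1 (denominator nonzero, equation cleared of denominators).
Equivalent : (N : ℕ) → QSqrt N → QSqrt N → Set
Equivalent N x y =
  ∃[ p ] ∃[ q ] ∃[ r ] ∃[ s ]
    ((p ℤ.* s ℤ.- q ℤ.* r ≡ ℤ.+ 1 ⊎ p ℤ.* s ℤ.- q ℤ.* r ≡ ℤ.- (+ 1))
    × ¬ (ι N r ⊗ x ⊕ ι N s ≡ ι N (+ 0))
    × (y ⊗ (ι N r ⊗ x ⊕ ι N s) ≡ ι N p ⊗ x ⊕ ι N q))

-- Equivalence of √N and u + v√N through the matrix (p q; r s) amounts to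
-- p√N + q = (u + v√N)(r√N + s), i.e. p = ur + vs and q = us + vNr; the denominator
-- r√N + s cannot vanish when ps − qr = ±1.  As N = A² − 4 only depends on ±A, we may
-- take A = ±a with 4p = A + 1, and then (p, pA − 1; 1, A) has determinant 1 and sends
-- √N to (√N + 1)/4.  The map y ↦ −ȳ fixes √N, preserves equivalence to it, and sends
-- (√N + 1)/4 to (√N − 1)/4.
module Submission where

open import Defs
open import Data.Nat using (ℕ; _<_; _*_; _∸_; _%_)
open import Data.Integer using (+_; -[1+_])
open import Data.Rational using (_/_)
open import Data.Product using (_×_)
open import Relation.Binary.PropositionalEquality using (_≡_)

open import Data.Nat as ℕ using (suc; _+_; _≤_; s≤s; z≤n)
import Data.Nat.Properties as ℕP
open import Data.Integer as ℤ using (ℤ)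
import Data.Integer.Properties as ℤP
import Data.Integer.Tactic.RingSolver as ℤ-Solver
open import Data.Rational as ℚ using (ℚ; 0ℚ; toℚᵘ)
import Data.Rational.Properties as ℚP
import Data.Rational.Unnormalised as ℚᵘ
import Data.Rational.Unnormalised.Properties as ℚᵘP
open import Data.Product using (_,_; ∃-syntax)
open import Data.Sum using (_⊎_; inj₁; inj₂)
open import Level using (0ℓ)
open import Relation.Binary.PropositionalEquality
  using (refl; sym; trans; cong; cong₂; subst; subst₂; module ≡-Reasoning)
open import Relation.Nullary using (¬_)
open import Relation.Nullary.Decidable using (dec⇒maybe)
import Tactic.RingSolver as Solver
open import Tactic.RingSolver.Core.AlmostCommutativeRing
  using (AlmostCommutativeRing; fromCommutativeRing)

ℚ-ring : AlmostCommutativeRing 0ℓ 0ℓ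
ℚ-ring = fromCommutativeRing ℚP.+-*-commutativeRing (λ x → dec⇒maybe (0ℚ ℚ.≟ x))

-- i / 1 is fromℚᵘ (mkℚᵘ i 0), so the embedding ℤ → ℚ is best studied in ℚᵘ, where
-- it is a ring homomorphism by computation.

toℚᵘ-/1 : ∀ i → toℚᵘ (i / 1) ℚᵘ.≃ ℚᵘ.mkℚᵘ i 0
toℚᵘ-/1 i = ℚP.toℚᵘ-fromℚᵘ (ℚᵘ.mkℚᵘ i 0)

/1-injective : ∀ i j → i / 1 ≡ j / 1 → i ≡ j
/1-injective i j eq with ℚP./-injective-≃ (ℚᵘ.mkℚᵘ i 0) (ℚᵘ.mkℚᵘ j 0) eq
... | ℚᵘ.*≡* i*1≡j*1 = trans (sym (ℤP.*-identityʳ i)) (trans i*1≡j*1 (ℤP.*-identityʳ j))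

/1-from-ℚᵘ : ∀ i x → ℚᵘ.mkℚᵘ i 0 ℚᵘ.≃ toℚᵘ x → i / 1 ≡ x
/1-from-ℚᵘ i x i≃x = ℚP.toℚᵘ-injective (ℚᵘP.≃-trans (toℚᵘ-/1 i) i≃x)

/1-homo-+ : ∀ i j → (i ℤ.+ j) / 1 ≡ (i / 1) ℚ.+ (j / 1)
/1-homo-+ i j = /1-from-ℚᵘ (i ℤ.+ j) ((i / 1) ℚ.+ (j / 1)) (begin
  ℚᵘ.mkℚᵘ (i ℤ.+ j) 0                   ≈⟨ ℚᵘ.*≡* (cross-mult i j) ⟩
  ℚᵘ.mkℚᵘ i 0 ℚᵘ.+ ℚᵘ.mkℚᵘ j 0          ≈⟨ ℚᵘP.+-cong (toℚᵘ-/1 i) (toℚᵘ-/1 j) ⟨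
  toℚᵘ (i / 1) ℚᵘ.+ toℚᵘ (j / 1)        ≈⟨ ℚP.toℚᵘ-homo-+ (i / 1) (j / 1) ⟨
  toℚᵘ ((i / 1) ℚ.+ (j / 1))            ∎)
  where
  open ℚᵘP.≃-Reasoning
  cross-mult : ∀ i j → (i ℤ.+ j) ℤ.* + 1 ≡ (i ℤ.* + 1 ℤ.+ j ℤ.* + 1) ℤ.* + 1
  cross-mult = ℤ-Solver.solve-∀

/1-homo-* : ∀ i j → (i ℤ.* j) / 1 ≡ (i / 1) ℚ.* (j / 1)
/1-homo-* i j = /1-from-ℚᵘ (i ℤ.* j) ((i / 1) ℚ.* (j / 1)) (begin
  ℚᵘ.mkℚᵘ (i ℤ.* j) 0                   ≈⟨ ℚᵘ.*≡* refl ⟩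
  ℚᵘ.mkℚᵘ i 0 ℚᵘ.* ℚᵘ.mkℚᵘ j 0          ≈⟨ ℚᵘP.*-cong (toℚᵘ-/1 i) (toℚᵘ-/1 j) ⟨
  toℚᵘ (i / 1) ℚᵘ.* toℚᵘ (j / 1)        ≈⟨ ℚP.toℚᵘ-homo-* (i / 1) (j / 1) ⟨
  toℚᵘ ((i / 1) ℚ.* (j / 1))            ∎)
  where open ℚᵘP.≃-Reasoning

/1-homo-neg : ∀ i → (ℤ.- i) / 1 ≡ ℚ.- (i / 1)
/1-homo-neg i = /1-from-ℚᵘ (ℤ.- i) (ℚ.- (i / 1)) (begin
  ℚᵘ.mkℚᵘ (ℤ.- i) 0                     ≈⟨ ℚᵘ.*≡* refl ⟩
  ℚᵘ.- ℚᵘ.mkℚᵘ i 0                      ≈⟨ ℚᵘP.-‿cong (toℚᵘ-/1 i) ⟨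
  ℚᵘ.- toℚᵘ (i / 1)                     ≈⟨ ℚP.toℚᵘ-homo‿- (i / 1) ⟨
  toℚᵘ (ℚ.- (i / 1))                    ∎)
  where open ℚᵘP.≃-Reasoning

¼ : ℚ
¼ = + 1 / 4

/1-quarter : ∀ x X → + 4 ℤ.* x ≡ X → x / 1 ≡ ¼ ℚ.* (X / 1)
/1-quarter x X 4x≡X = begin
  x / 1                              ≡⟨ ℚP.*-identityˡ (x / 1) ⟨
  (¼ ℚ.* (+ 4 / 1)) ℚ.* (x / 1)      ≡⟨ ℚP.*-assoc ¼ (+ 4 / 1) (x / 1) ⟩
  ¼ ℚ.* ((+ 4 / 1) ℚ.* (x / 1))      ≡⟨ cong (¼ ℚ.*_) (/1-homo-* (+ 4) x) ⟨
  ¼ ℚ.* ((+ 4 ℤ.* x) / 1)            ≡⟨ cong (λ y → ¼ ℚ.* (y / 1)) 4x≡X ⟩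
  ¼ ℚ.* (X / 1)                      ∎
  where open ≡-Reasoning

Unimodular : ℤ → ℤ → ℤ → ℤ → Set
Unimodular p q r s = p ℤ.* s ℤ.- q ℤ.* r ≡ + 1 ⊎ p ℤ.* s ℤ.- q ℤ.* r ≡ ℤ.- (+ 1)

module _ (N : ℕ) where

  private
    n : ℚ
    n = + N / 1

  ι⊗√N⊕ι : ∀ r s → ι N r ⊗ √N N ⊕ ι N s ≡ (s / 1) + (r / 1) √
  ι⊗√N⊕ι r s = cong₂ _+_√ (re-identity n (r / 1) (s / 1)) (im-identity (r / 1))
    where
    re-identity : ∀ n r s → r ℚ.* 0ℚ ℚ.+ n ℚ.* (0ℚ ℚ.* ℚ.1ℚ) ℚ.+ s ≡ s
    re-identity = Solver.solve-∀ ℚ-ring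
    im-identity : ∀ r → r ℚ.* ℚ.1ℚ ℚ.+ 0ℚ ℚ.* 0ℚ ℚ.+ 0ℚ ≡ r
    im-identity = Solver.solve-∀ ℚ-ring

  unimodular⇒denominator≢0 : ∀ p q r s → Unimodular p q r s →
    ¬ (ι N r ⊗ √N N ⊕ ι N s ≡ ι N (+ 0))
  unimodular⇒denominator≢0 p q r s det r√N+s≡0 =
    not-unimodular (subst₂ (Unimodular p q) r≡0 s≡0 det)
    where
    s+r√≡0 : (s / 1) + (r / 1) √ ≡ ι N (+ 0)
    s+r√≡0 = trans (sym (ι⊗√N⊕ι r s)) r√N+s≡0
    r≡0 : r ≡ + 0
    r≡0 = /1-injective r (+ 0) (cong QSqrt.im s+r√≡0)
    s≡0 : s ≡ + 0
    s≡0 = /1-injective s (+ 0) (cong QSqrt.re s+r√≡0)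
    det-zero : ∀ p q → p ℤ.* + 0 ℤ.- q ℤ.* + 0 ≡ + 0
    det-zero = ℤ-Solver.solve-∀
    not-unimodular : ¬ Unimodular p q (+ 0) (+ 0)
    not-unimodular (inj₁ det≡1) with trans (sym (det-zero p q)) det≡1
    ... | ()
    not-unimodular (inj₂ det≡-1) with trans (sym (det-zero p q)) det≡-1
    ... | ()

  equivalent-√N : ∀ u v p q r s → Unimodular p q r s →
    p / 1 ≡ u ℚ.* (r / 1) ℚ.+ v ℚ.* (s / 1) →
    q / 1 ≡ u ℚ.* (s / 1) ℚ.+ n ℚ.* (v ℚ.* (r / 1)) →
    Equivalent N (√N N) (u + v √)
  equivalent-√N u v p q r s det p≡ur+vs q≡us+vNr =
    p , q , r , s , det , unimodular⇒denominator≢0 p q r s det , (begin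
      (u + v √) ⊗ (ι N r ⊗ √N N ⊕ ι N s)  ≡⟨ cong ((u + v √) ⊗_) (ι⊗√N⊕ι r s) ⟩
      (u + v √) ⊗ ((s / 1) + (r / 1) √)  ≡⟨ cong₂ _+_√ q≡us+vNr p≡ur+vs ⟨
      (q / 1) + (p / 1) √                ≡⟨ ι⊗√N⊕ι p q ⟨
      ι N p ⊗ √N N ⊕ ι N q               ∎)
    where open ≡-Reasoning

  -- On matrices, y ↦ −ȳ is conjugation by diag(1, −1).
  equivalent-√N-neg-conj : ∀ u v → Equivalent N (√N N) (u + v √) →
    Equivalent N (√N N) ((ℚ.- u) + v √)
  equivalent-√N-neg-conj u v (p , q , r , s , det , _ , eq) =
    equivalent-√N (ℚ.- u) v p (ℤ.- q) (ℤ.- r) s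
      (subst (λ d → d ≡ + 1 ⊎ d ≡ ℤ.- (+ 1)) (sym (det-neg p q r s)) det) p≡ q≡
    where
    open ≡-Reasoning
    R S : ℚ
    R = r / 1
    S = s / 1
    components : (u ℚ.* S ℚ.+ n ℚ.* (v ℚ.* R)) + (u ℚ.* R ℚ.+ v ℚ.* S) √ ≡ (q / 1) + (p / 1) √
    components = begin
      (u + v √) ⊗ (S + R √)                ≡⟨ cong ((u + v √) ⊗_) (ι⊗√N⊕ι r s) ⟨
      (u + v √) ⊗ (ι N r ⊗ √N N ⊕ ι N s)  ≡⟨ eq ⟩
      ι N p ⊗ √N N ⊕ ι N q                 ≡⟨ ι⊗√N⊕ι p q ⟩
      (q / 1) + (p / 1) √                  ∎
    det-neg : ∀ p q r s → p ℤ.* s ℤ.- (ℤ.- q) ℤ.* (ℤ.- r) ≡ p ℤ.* s ℤ.- q ℤ.* r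
    det-neg = ℤ-Solver.solve-∀
    im-neg : ∀ u v R S → u ℚ.* R ℚ.+ v ℚ.* S ≡ (ℚ.- u) ℚ.* (ℚ.- R) ℚ.+ v ℚ.* S
    im-neg = Solver.solve-∀ ℚ-ring
    re-neg : ∀ n u v R S →
      ℚ.- (u ℚ.* S ℚ.+ n ℚ.* (v ℚ.* R)) ≡ (ℚ.- u) ℚ.* S ℚ.+ n ℚ.* (v ℚ.* (ℚ.- R))
    re-neg = Solver.solve-∀ ℚ-ring
    p≡ : p / 1 ≡ (ℚ.- u) ℚ.* ((ℤ.- r) / 1) ℚ.+ v ℚ.* S
    p≡ = begin
      p / 1                               ≡⟨ cong QSqrt.im components ⟨
      u ℚ.* R ℚ.+ v ℚ.* S                 ≡⟨ im-neg u v R S ⟩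
      (ℚ.- u) ℚ.* (ℚ.- R) ℚ.+ v ℚ.* S     ≡⟨ cong (λ x → (ℚ.- u) ℚ.* x ℚ.+ v ℚ.* S) (/1-homo-neg r) ⟨
      (ℚ.- u) ℚ.* ((ℤ.- r) / 1) ℚ.+ v ℚ.* S ∎
    q≡ : (ℤ.- q) / 1 ≡ (ℚ.- u) ℚ.* S ℚ.+ n ℚ.* (v ℚ.* ((ℤ.- r) / 1))
    q≡ = begin
      (ℤ.- q) / 1                                   ≡⟨ /1-homo-neg q ⟩
      ℚ.- (q / 1)                                   ≡⟨ cong ℚ.-_ (cong QSqrt.re components) ⟨
      ℚ.- (u ℚ.* S ℚ.+ n ℚ.* (v ℚ.* R))             ≡⟨ re-neg n u v R S ⟩
      (ℚ.- u) ℚ.* S ℚ.+ n ℚ.* (v ℚ.* (ℚ.- R))       ≡⟨ cong (λ x → (ℚ.- u) ℚ.* S ℚ.+ n ℚ.* (v ℚ.* x)) (/1-homo-neg r) ⟨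
      (ℚ.- u) ℚ.* S ℚ.+ n ℚ.* (v ℚ.* ((ℤ.- r) / 1)) ∎

  ¼+¼√N-equivalent-√N : ∀ A p → + N ≡ A ℤ.* A ℤ.- + 4 → + 4 ℤ.* p ≡ A ℤ.+ + 1 →
    Equivalent N (√N N) (¼ + ¼ √)
  ¼+¼√N-equivalent-√N A p N≡A²-4 4p≡A+1 =
    equivalent-√N ¼ ¼ p (p ℤ.* A ℤ.- + 1) (+ 1) A (inj₁ (det≡1 p A)) p≡ q≡
    where
    open ≡-Reasoning
    det≡1 : ∀ p A → p ℤ.* A ℤ.- (p ℤ.* A ℤ.- + 1) ℤ.* + 1 ≡ + 1
    det≡1 = ℤ-Solver.solve-∀
    expand : ∀ p A → + 4 ℤ.* (p ℤ.* A ℤ.- + 1) ≡ (+ 4 ℤ.* p) ℤ.* A ℤ.- + 4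
    expand = ℤ-Solver.solve-∀
    regroup : ∀ A → (A ℤ.+ + 1) ℤ.* A ℤ.- + 4 ≡ A ℤ.+ (A ℤ.* A ℤ.- + 4) ℤ.* + 1
    regroup = ℤ-Solver.solve-∀
    distrib : ∀ f a n o → f ℚ.* (a ℚ.+ n ℚ.* o) ≡ f ℚ.* a ℚ.+ n ℚ.* (f ℚ.* o)
    distrib = Solver.solve-∀ ℚ-ring
    4q≡A+N : + 4 ℤ.* (p ℤ.* A ℤ.- + 1) ≡ A ℤ.+ + N ℤ.* + 1
    4q≡A+N = begin
      + 4 ℤ.* (p ℤ.* A ℤ.- + 1)          ≡⟨ expand p A ⟩
      (+ 4 ℤ.* p) ℤ.* A ℤ.- + 4          ≡⟨ cong (λ x → x ℤ.* A ℤ.- + 4) 4p≡A+1 ⟩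
      (A ℤ.+ + 1) ℤ.* A ℤ.- + 4          ≡⟨ regroup A ⟩
      A ℤ.+ (A ℤ.* A ℤ.- + 4) ℤ.* + 1    ≡⟨ cong (λ m → A ℤ.+ m ℤ.* + 1) N≡A²-4 ⟨
      A ℤ.+ + N ℤ.* + 1                  ∎
    p≡ : p / 1 ≡ ¼ ℚ.* (+ 1 / 1) ℚ.+ ¼ ℚ.* (A / 1)
    p≡ = begin
      p / 1                              ≡⟨ /1-quarter p (+ 1 ℤ.+ A) (trans 4p≡A+1 (ℤP.+-comm A (+ 1))) ⟩
      ¼ ℚ.* ((+ 1 ℤ.+ A) / 1)            ≡⟨ cong (¼ ℚ.*_) (/1-homo-+ (+ 1) A) ⟩
      ¼ ℚ.* ((+ 1 / 1) ℚ.+ (A / 1))      ≡⟨ ℚP.*-distribˡ-+ ¼ (+ 1 / 1) (A / 1) ⟩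
      ¼ ℚ.* (+ 1 / 1) ℚ.+ ¼ ℚ.* (A / 1)  ∎
    q≡ : (p ℤ.* A ℤ.- + 1) / 1 ≡ ¼ ℚ.* (A / 1) ℚ.+ n ℚ.* (¼ ℚ.* (+ 1 / 1))
    q≡ = begin
      (p ℤ.* A ℤ.- + 1) / 1                     ≡⟨ /1-quarter _ _ 4q≡A+N ⟩
      ¼ ℚ.* ((A ℤ.+ + N ℤ.* + 1) / 1)           ≡⟨ cong (¼ ℚ.*_) (/1-homo-+ A (+ N ℤ.* + 1)) ⟩
      ¼ ℚ.* ((A / 1) ℚ.+ (+ N ℤ.* + 1) / 1)     ≡⟨ cong (λ x → ¼ ℚ.* ((A / 1) ℚ.+ x)) (/1-homo-* (+ N) (+ 1)) ⟩
      ¼ ℚ.* ((A / 1) ℚ.+ n ℚ.* (+ 1 / 1))       ≡⟨ distrib ¼ (A / 1) n (+ 1 / 1) ⟩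
      ¼ ℚ.* (A / 1) ℚ.+ n ℚ.* (¼ ℚ.* (+ 1 / 1)) ∎

odd⇒≡3∨≡1-mod-4 : ∀ a → a % 2 ≡ 1 → ∃[ k ] (a ≡ 4 * k + 3 ⊎ a ≡ 4 * k + 1)
odd⇒≡3∨≡1-mod-4 0 ()
odd⇒≡3∨≡1-mod-4 1 _ = 0 , inj₂ refl
odd⇒≡3∨≡1-mod-4 2 ()
odd⇒≡3∨≡1-mod-4 3 _ = 0 , inj₁ refl
odd⇒≡3∨≡1-mod-4 (suc (suc (suc (suc a)))) odd with odd⇒≡3∨≡1-mod-4 a odd
... | k , inj₁ a≡4k+3 = suc k , inj₁ (trans (cong (4 ℕ.+_) a≡4k+3) (cong (_+ 3) (sym (ℕP.*-suc 4 k))))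
... | k , inj₂ a≡4k+1 = suc k , inj₂ (trans (cong (4 ℕ.+_) a≡4k+1) (cong (_+ 1) (sym (ℕP.*-suc 4 k))))

pos-4k+c : ∀ k c → + (4 * k + c) ≡ + 4 ℤ.* + k ℤ.+ + c
pos-4k+c k c = trans (ℤP.pos-+ (4 * k) c) (cong (ℤ._+ + c) (ℤP.pos-* 4 k))

odd⇒±a≡-1-mod-4 : ∀ a → a % 2 ≡ 1 →
  ∃[ A ] ∃[ p ] (A ℤ.* A ≡ + a ℤ.* + a × + 4 ℤ.* p ≡ A ℤ.+ + 1)
odd⇒±a≡-1-mod-4 a odd with odd⇒≡3∨≡1-mod-4 a odd
... | k , inj₁ refl = + a , + k ℤ.+ + 1 , refl , (begin
  + 4 ℤ.* (+ k ℤ.+ + 1)          ≡⟨ 4[k+1] (+ k) ⟩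
  (+ 4 ℤ.* + k ℤ.+ + 3) ℤ.+ + 1  ≡⟨ cong (ℤ._+ + 1) (pos-4k+c k 3) ⟨
  + a ℤ.+ + 1                    ∎)
  where
  open ≡-Reasoning
  4[k+1] : ∀ k → + 4 ℤ.* (k ℤ.+ + 1) ≡ (+ 4 ℤ.* k ℤ.+ + 3) ℤ.+ + 1
  4[k+1] = ℤ-Solver.solve-∀
... | k , inj₂ refl = ℤ.- + a , ℤ.- + k , neg-square (+ a) , (begin
  + 4 ℤ.* (ℤ.- + k)                    ≡⟨ 4[-k] (+ k) ⟩
  ℤ.- (+ 4 ℤ.* + k ℤ.+ + 1) ℤ.+ + 1    ≡⟨ cong (λ x → ℤ.- x ℤ.+ + 1) (pos-4k+c k 1) ⟨
  ℤ.- + a ℤ.+ + 1                      ∎)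
  where
  open ≡-Reasoning
  neg-square : ∀ x → (ℤ.- x) ℤ.* (ℤ.- x) ≡ x ℤ.* x
  neg-square = ℤ-Solver.solve-∀
  4[-k] : ∀ k → + 4 ℤ.* (ℤ.- k) ≡ ℤ.- (+ 4 ℤ.* k ℤ.+ + 1) ℤ.+ + 1
  4[-k] = ℤ-Solver.solve-∀

pos[a*a∸4] : ∀ a → 3 < a → + (a * a ∸ 4) ≡ + a ℤ.* + a ℤ.- + 4
pos[a*a∸4] a 3<a = begin
  + (a * a ∸ 4)        ≡⟨ ℤP.⊖-≥ 4≤a*a ⟨
  (a * a) ℤ.⊖ 4        ≡⟨ ℤP.m-n≡m⊖n (a * a) 4 ⟨
  + (a * a) ℤ.- + 4    ≡⟨ cong (ℤ._- + 4) (ℤP.pos-* a a) ⟩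
  + a ℤ.* + a ℤ.- + 4  ∎
  where
  open ≡-Reasoning
  4≤a*a : 4 ≤ a * a
  4≤a*a = ℕP.*-mono-≤ {1} (ℕP.≤-trans (s≤s z≤n) 3<a) 3<a

mainTheorem2 : (a : ℕ) → 3 < a → a % 2 ≡ 1 →
    Equivalent (a * a ∸ 4) (√N (a * a ∸ 4)) (((+ 1) / 4) + ((+ 1) / 4) √)
    × Equivalent (a * a ∸ 4) (√N (a * a ∸ 4)) ((-[1+ 0 ] / 4) + ((+ 1) / 4) √)
mainTheorem2 a 3<a odd with odd⇒±a≡-1-mod-4 a odd
... | A , p , A²≡a² , 4p≡A+1 = √N~¼+¼√N , equivalent-√N-neg-conj N ¼ ¼ √N~¼+¼√N
  where
  N : ℕ
  N = a * a ∸ 4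
  √N~¼+¼√N : Equivalent N (√N N) (¼ + ¼ √)
  √N~¼+¼√N = ¼+¼√N-equivalent-√N N A p
    (trans (pos[a*a∸4] a 3<a) (cong (ℤ._- + 4) (sym A²≡a²))) 4p≡A+1
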